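{- Let $d=(d_1,\ldots,d_n)$ be a sequence of positive integers, $\gamma\in[1,n]$, and $G_{d,\gamma}$ the flow network described in the context. Let $(S,T)$ be an $s$-$t$ cut of $G_{d,\gamma}$ with $T\cap Y_D\ne\emptyset$. Let $Z=\{x_i\in S : x'_i\notin S,\ i\in[\gamma+1,n]\}$, $Z'=\{x'_i\in S : x_i\notin S,\ i\in[\gamma+1,n]\}$, $S'=S\setminus(Z\cup Z')$ and $T'=T\cup Z\cup Z'$. Then $c(S',T')\le c(S,T)$.
   Context: The network $G_{d,\gamma}$ has node set $\{s,t\}\cup X\cup Y\cup X'_S\cup Y'_S$, where $X=\{x_1,\ldots,x_n\}$, $Y=\{y_1,\ldots,y_n\}$, $X_D=\{x_i:i\in[1,\gamma]\}$, $Y_D=\{y_j:j\in[1,\gamma]\}$, $X_S=\{x_i:i\in[\gamma+1,n]\}$, $Y_S=\{y_j:j\in[\gamma+1,n]\}$, $X'_S=\{x'_i:i\in[\gamma+1,n]\}$, $Y'_S=\{y'_j:j\in[\gamma+1,n]\}$. Its directed edges with capacities are: $(s,x_i)$ cap. $d_i$ and $(y_i,t)$ cap. $d_i$ for $i\in[1,n]$; $(x_i,y_j)$ cap. 1 for $i,j\in[1,\gamma]$, $i\ne j$; $(x_i,y_j)$ cap. 1 for $i\in[1,\gamma]$, $j\in[\gamma+1,n]$; $(x_i,y_j)$ cap. 1 for $i\in[\gamma+1,n]$, $j\in[1,\gamma]$; $(x_i,x'_i)$ cap. $d_i-1$ and $(y'_i,y_i)$ cap. $d_i-1$ for $i\in[\gamma+1,n]$;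 $(x'_i,y'_j)$ cap. 1 for $i,j\in[\gamma+1,n]$, $i\ne j$. An $s$-$t$ cut is a partition $(S,T)$ of the node set with $s\in S$, $t\in T$; its capacity $c(S,T)$ is the total capacity of edges directed from $S$ to $T$. $[a,b]=\{a,\ldots,b\}$. -}

module Defs where

open import Data.Nat using (ℕ; zero; suc; _+_; _∸_; _≤_; _<_; _≤?_; _<?_)
open import Data.Fin using (Fin; toℕ) renaming (_≟_ to _≟ᶠ_)
open import Data.Bool using (Bool; true; false; _∧_; _∨_; not; if_then_else_)
open import Data.List using (List; []; _∷_; _++_; map; concatMap; allFin)
open import Data.Nat.ListAction using (sum)
open import Data.Product using (_×_)
open import Relation.Binary.PropositionalEquality using (_≡_)
open import Relation.Nullary using (yes; no; does)

-- Indexing convention: the paper's index i ∈ [1,n] is represented by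
-- i : Fin n with toℕ i = i - 1.  Hence
--   i ∈ [1,γ]    ↔  toℕ i < γ      (the "D" indices)
--   i ∈ [γ+1,n]  ↔  γ ≤ toℕ i      (the "S" indices)

-- Nodes of G_{d,γ}.  The primed copies x'_i, y'_i exist only for
-- S indices, enforced by an (irrelevant) proof argument.
data Node (n γ : ℕ) : Set where
  s  : Node n γ
  t  : Node n γ
  x  : Fin n → Node n γ
  y  : Fin n → Node n γ
  x' : (i : Fin n) → .(γ ≤ toℕ i) → Node n γ
  y' : (i : Fin n) → .(γ ≤ toℕ i) → Node n γ

primedNodes : {n γ : ℕ} → ((i : Fin n) → .(γ ≤ toℕ i) → Node n γ) → List (Node n γ)
primedNodes {n} {γ} f = concatMap g (allFin n)
  where
  g : Fin n → List (Node n γ)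
  g i with γ ≤? toℕ i
  ... | yes p = f i p ∷ []
  ... | no _  = []

allNodes : (n γ : ℕ) → List (Node n γ)
allNodes n γ = s ∷ t ∷ (map x (allFin n) ++ map y (allFin n)
               ++ primedNodes x' ++ primedNodes y')

isD : {n : ℕ} (γ : ℕ) → Fin n → Bool
isD γ i = does (toℕ i <? γ)

eqᶠ : {n : ℕ} → Fin n → Fin n → Bool
eqᶠ i j = does (i ≟ᶠ j)

b2n : Bool → ℕ
b2n true  = 1
b2n false = 0

cap : {n γ : ℕ} → (Fin n → ℕ) → Node n γ → Node n γ → ℕ
cap d s (x i) = d i
cap d (y i) t = d i
cap {γ = γ} d (x i) (y j) =
  b2n ((isD γ i ∧ isD γ j ∧ not (eqᶠ i j))
       ∨ (isD γ i ∧ not (isD γ j))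
       ∨ (not (isD γ i) ∧ isD γ j))
cap d (x i) (x' j _) = if eqᶠ i j then d i ∸ 1 else 0
cap d (y' i _) (y j) = if eqᶠ i j then d i ∸ 1 else 0
cap d (x' i _) (y' j _) = b2n (not (eqᶠ i j))
cap d _ _ = 0

-- A cut is given by the characteristic function of its source side S
-- (true = in S, false = in T).
IsCut : {n γ : ℕ} → (Node n γ → Bool) → Set
IsCut S = (S s ≡ true) × (S t ≡ false)

cutCap : {n γ : ℕ} → (Fin n → ℕ) → (Node n γ → Bool) → ℕ
cutCap {n} {γ} d S =
  sum (map (λ u → sum (map (λ v → if S u ∧ not (S v) then cap d u v else 0)
                           (allNodes n γ)))
           (allNodes n γ))

inZ : {n γ : ℕ} → (Node n γ → Bool) → Node n γ → Bool
inZ {γ = γ} S (x i) with γ ≤? toℕ i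
... | yes p = S (x i) ∧ not (S (x' i p))
... | no _  = false
inZ S _ = false

inZ' : {n γ : ℕ} → (Node n γ → Bool) → Node n γ → Bool
inZ' S (x' i p) = S (x' i p) ∧ not (S (x i))
inZ' S _ = false

-- S' = S \ (Z ∪ Z')   (so T' = complement of S' = T ∪ Z ∪ Z')
S'of : {n γ : ℕ} → (Node n γ → Bool) → Node n γ → Bool
S'of S v = S v ∧ not (inZ S v ∨ inZ' S v)

{-# OPTIONS --safe #-}
-- Moving Z ∪ Z' from S to T removes the cut edges leaving Z ∪ Z' and adds the edges from S'
-- into Z ∪ Z', so c(S',T') + c(Z ∪ Z', T) = c(S,T) + c(S', Z ∪ Z').  The only edges into x_i
-- come from s, and the only edge into x'_i comes from x_i, which lies in T when x'_i ∈ Z';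
-- hence c(S', Z ∪ Z') ≤ Σ_{x_i ∈ Z} d_i.  Each x_i ∈ Z keeps in the cut its edge to x'_i ∈ T
-- (capacity d_i - 1) and, as i > γ, its edge to the given y_j ∈ T ∩ Y_D (capacity 1), so
-- c(Z ∪ Z', T) ≥ Σ_{x_i ∈ Z} d_i as well.
module Submission where

open import Defs
open import Data.Nat using (ℕ; _≤_; _<_)
open import Data.Fin using (Fin; toℕ)
open import Data.Bool using (Bool; false)
open import Data.Product using (Σ; _×_)
open import Relation.Binary.PropositionalEquality using (_≡_)

open import Data.Bool using (true; _∧_; _∨_; not; if_then_else_)
open import Data.Bool.Properties using (∧-conicalˡ; ∧-conicalʳ)
open import Data.Empty using (⊥-elim)
open import Data.Fin using () renaming (_≟_ to _≟ᶠ_)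
open import Data.List using (List; []; _∷_; _++_; map; concat; concatMap; allFin)
open import Data.List.Membership.Propositional using (_∈_)
open import Data.List.Membership.Propositional.Properties using (∈-allFin; ∈-map⁺; ∈-++⁺ˡ; ∈-concat⁺′)
open import Data.List.Properties using (map-cong; map-++)
open import Data.List.Relation.Unary.All as All using (All; []; _∷_)
open import Data.List.Relation.Unary.All.Properties using (++⁺; map⁺; concat⁺)
open import Data.List.Relation.Unary.Any using (here; there)
open import Data.Nat using (z≤n; _≤?_; _<?_; _∸_; _+_)
open import Data.Nat.ListAction using (sum)
open import Data.Nat.ListAction.Properties using (sum-++)
open import Data.Nat.Properties
open import Algebra.Properties.CommutativeSemigroup +-commutativeSemigroup using (interchange)
open import Data.Product using (_,_; proj₁; proj₂)
open import Relation.Binary.PropositionalEquality using (refl; sym; trans; cong; cong₂; _≢_; module ≡-Reasoning)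
open import Relation.Nullary using (yes; no)
open import Relation.Nullary.Decidable using (dec-true; dec-false)

module _ {A : Set} where

  sum-map-+ : (f g : A → ℕ) (xs : List A) →
              sum (map (λ a → f a + g a) xs) ≡ sum (map f xs) + sum (map g xs)
  sum-map-+ f g []       = refl
  sum-map-+ f g (a ∷ xs) =
    trans (cong (f a + g a +_) (sum-map-+ f g xs)) (interchange (f a) (g a) _ _)

  sum-map-+-cong : {f g h k : A → ℕ} → (∀ a → f a + g a ≡ h a + k a) → (xs : List A) →
                   sum (map f xs) + sum (map g xs) ≡ sum (map h xs) + sum (map k xs)
  sum-map-+-cong {f} {g} {h} {k} eq xs = begin
    sum (map f xs) + sum (map g xs)  ≡⟨ sum-map-+ f g xs ⟨
    sum (map (λ a → f a + g a) xs)   ≡⟨ cong sum (map-cong eq xs) ⟩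
    sum (map (λ a → h a + k a) xs)   ≡⟨ sum-map-+ h k xs ⟩
    sum (map h xs) + sum (map k xs)  ∎
    where open ≡-Reasoning

  sum-map-++ : (f : A → ℕ) (xs ys : List A) →
               sum (map f (xs ++ ys)) ≡ sum (map f xs) + sum (map f ys)
  sum-map-++ f xs ys = trans (cong sum (map-++ f xs ys)) (sum-++ (map f xs) (map f ys))

  sum-map-mono : {f g : A → ℕ} → (∀ a → f a ≤ g a) → (xs : List A) →
                 sum (map f xs) ≤ sum (map g xs)
  sum-map-mono f≤g []       = z≤n
  sum-map-mono f≤g (a ∷ xs) = +-mono-≤ (f≤g a) (sum-map-mono f≤g xs)

  sum-map-zero : {f : A → ℕ} {xs : List A} → All (λ a → f a ≡ 0) xs → sum (map f xs) ≡ 0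
  sum-map-zero []             = refl
  sum-map-zero (fa≡0 ∷ fxs≡0) = cong₂ _+_ fa≡0 (sum-map-zero fxs≡0)

  ∈⇒≤-sum-map : (f : A → ℕ) {a : A} {xs : List A} → a ∈ xs → f a ≤ sum (map f xs)
  ∈⇒≤-sum-map f (here refl)  = m≤m+n _ _
  ∈⇒≤-sum-map f (there a∈xs) = ≤-trans (∈⇒≤-sum-map f a∈xs) (m≤n+m _ _)

not≡true⇒≡false : {b : Bool} → not b ≡ true → b ≡ false
not≡true⇒≡false {false} _ = refl

-- The edge (u,v) as counted in cut (S ∖ M), flow M (∁ S), cut S and flow (S ∖ M) M,
-- where a = S u, m = M u, b = S v, m′ = M v.
if-move : {a m b m′ : Bool} {k : ℕ} → (m ≡ true → a ≡ true) → (m′ ≡ true → b ≡ true) →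
          (if (a ∧ not m) ∧ not (b ∧ not m′) then k else 0) + (if m ∧ not b then k else 0)
          ≡ (if a ∧ not b then k else 0) + (if (a ∧ not m) ∧ m′ then k else 0)
if-move {false} {false}                   _ _ = refl
if-move {false} {true}                    m⇒a _ with () ← m⇒a refl
if-move {true}  {true}  {b}               _ _ = sym (+-identityʳ (if not b then _ else 0))
if-move {true}  {false} {false} {false}   _ _ = refl
if-move {true}  {false} {false} {true}    _ m′⇒b with () ← m′⇒b refl
if-move {true}  {false} {true}  {false}   _ _ = refl
if-move {true}  {false} {true}  {true} {k} _ _ = +-identityʳ k

_∖_ : {V : Set} → (V → Bool) → (V → Bool) → V → Bool
(A ∖ B) v = A v ∧ not (B v)

∁ : {V : Set} → (V → Bool) → V → Bool
∁ A v = not (A v)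

module Flow {V : Set} (nodes : List V) (c : V → V → ℕ) where

  edgeCap : (A B : V → Bool) → V → V → ℕ
  edgeCap A B u v = if A u ∧ B v then c u v else 0

  flowFrom : (A B : V → Bool) → V → ℕ
  flowFrom A B u = sum (map (edgeCap A B u) nodes)

  flow : (A B : V → Bool) → ℕ
  flow A B = sum (map (flowFrom A B) nodes)

  cut : (V → Bool) → ℕ
  cut S = flow S (∁ S)

  cut-∖ : (S M : V → Bool) → (∀ v → M v ≡ true → S v ≡ true) →
          cut (S ∖ M) + flow M (∁ S) ≡ cut S + flow (S ∖ M) M
  cut-∖ S M M⊆S =
    sum-map-+-cong (λ u → sum-map-+-cong (λ v → if-move (M⊆S u) (M⊆S v)) nodes) nodes

  cut-∖-≤ : (S M : V → Bool) → (∀ v → M v ≡ true → S v ≡ true) →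
            flow (S ∖ M) M ≤ flow M (∁ S) → cut (S ∖ M) ≤ cut S
  cut-∖-≤ S M M⊆S in≤out = +-cancelʳ-≤ (flow M (∁ S)) _ _ (begin
    cut (S ∖ M) + flow M (∁ S)  ≡⟨ cut-∖ S M M⊆S ⟩
    cut S + flow (S ∖ M) M      ≤⟨ +-monoʳ-≤ (cut S) in≤out ⟩
    cut S + flow M (∁ S)        ∎)
    where open ≤-Reasoning

  edgeCap-≡ : (A B : V → Bool) (u v : V) → A u ≡ true → B v ≡ true → edgeCap A B u v ≡ c u v
  edgeCap-≡ A B u v Au Bv rewrite Au | Bv = refl

  edgeCap-≤ : (A B : V → Bool) (u v : V) {m : ℕ} → (A u ≡ true → B v ≡ true → c u v ≤ m) →
              edgeCap A B u v ≤ m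
  edgeCap-≤ A B u v cap≤m with A u | B v
  ... | true  | true  = cap≤m refl refl
  ... | true  | false = z≤n
  ... | false | _     = z≤n

  edgeCap-≡0 : (A B : V → Bool) (u v : V) → (A u ≡ true → B v ≡ true → c u v ≡ 0) →
               edgeCap A B u v ≡ 0
  edgeCap-≡0 A B u v cap≡0 = n≤0⇒n≡0 (edgeCap-≤ A B u v (λ Au Bv → ≤-reflexive (cap≡0 Au Bv)))

module _ {n γ : ℕ} where

  primedAt : ((i : Fin n) → .(γ ≤ toℕ i) → Node n γ) → Fin n → List (Node n γ)
  primedAt f i with γ ≤? toℕ i
  ... | yes p = f i p ∷ []
  ... | no _  = []

  mutual
    primedNodes-≡ : (f : (i : Fin n) → .(γ ≤ toℕ i) → Node n γ) →
                    primedNodes f ≡ concatMap (primedAt f) (allFin n)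
    primedNodes-≡ f = cong concat (map-cong (primedAt-agrees f) (allFin n))

    -- The left-hand side is the local helper of primedNodes, which has no name outside Defs.
    primedAt-agrees : (f : (i : Fin n) → .(γ ≤ toℕ i) → Node n γ) (i : Fin n) → _ ≡ primedAt f i
    primedAt-agrees f i with γ ≤? toℕ i
    ... | yes _ = refl
    ... | no _  = refl

  All-primedNodes : {P : Node n γ → Set} (f : (i : Fin n) → .(γ ≤ toℕ i) → Node n γ) →
                    (∀ i p → P (f i p)) → All P (primedNodes f)
  All-primedNodes {P} f Pf rewrite primedNodes-≡ f = concat⁺ (map⁺ (All.universal Pf-at (allFin n)))
    where
    Pf-at : (i : Fin n) → All P (primedAt f i)
    Pf-at i with γ ≤? toℕ i
    ... | yes p = Pf i p ∷ []
    ... | no _  = []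

  ∈-primedNodes : (f : (i : Fin n) → .(γ ≤ toℕ i) → Node n γ) (i : Fin n) (p : γ ≤ toℕ i) →
                  f i p ∈ primedNodes f
  ∈-primedNodes f i p rewrite primedNodes-≡ f = ∈-concat⁺′ ∈-at (∈-map⁺ (primedAt f) (∈-allFin i))
    where
    ∈-at : f i p ∈ primedAt f i
    ∈-at with γ ≤? toℕ i
    ... | yes _  = here refl
    ... | no γ≰i = ⊥-elim (γ≰i p)

  sum-allNodes-source : (F : Node n γ → ℕ) → (∀ u → u ≢ s → F u ≡ 0) →
                        sum (map F (allNodes n γ)) ≡ F s
  sum-allNodes-source F F≡0 = trans (cong (F s +_) (sum-map-zero (All.map (λ {u} → F≡0 u) others≢s)))
                                    (+-identityʳ (F s))
    where
    others≢s : All (_≢ s) (t ∷ map x (allFin n) ++ map y (allFin n) ++ primedNodes x' ++ primedNodes y')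
    others≢s = (λ ()) ∷ ++⁺ (map⁺ (All.universal (λ _ ()) (allFin n)))
                       (++⁺ (map⁺ (All.universal (λ _ ()) (allFin n)))
                       (++⁺ (All-primedNodes x' (λ _ _ ())) (All-primedNodes y' (λ _ _ ()))))

module _ {n γ : ℕ} (d : Fin n → ℕ) where

  cap-into-x : (u : Node n γ) (j : Fin n) → u ≢ s → cap d u (x j) ≡ 0
  cap-into-x s        _ s≢s = ⊥-elim (s≢s refl)
  cap-into-x t        _ _   = refl
  cap-into-x (x _)    _ _   = refl
  cap-into-x (y _)    _ _   = refl
  cap-into-x (x' _ _) _ _   = refl
  cap-into-x (y' _ _) _ _   = refl

  cap-x-x' : (i : Fin n) .(p : γ ≤ toℕ i) → cap d (x i) (x' i p) ≡ d i ∸ 1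
  cap-x-x' i p rewrite dec-true (i ≟ᶠ i) refl = refl

  cap-x-y : {i j : Fin n} → γ ≤ toℕ i → toℕ j < γ → cap {γ = γ} d (x i) (y j) ≡ 1
  cap-x-y {i} {j} γ≤i j<γ
    rewrite dec-false (toℕ i <? γ) (≤⇒≯ γ≤i) | dec-true (toℕ j <? γ) j<γ = refl

inZ∪Z' : {n γ : ℕ} → (Node n γ → Bool) → Node n γ → Bool
inZ∪Z' S v = inZ S v ∨ inZ' S v

module _ {n γ : ℕ} (S : Node n γ → Bool) where

  inZ∪Z'-x : (i : Fin n) → inZ∪Z' S (x i) ≡ true →
             Σ (γ ≤ toℕ i) λ p → (S (x i) ≡ true) × (S (x' i p) ≡ false)
  inZ∪Z'-x i Zi with γ ≤? toℕ i
  ... | no _  with () ← Zi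
  ... | yes p with S (x i) | S (x' i p)
  ...   | true  | false = p , refl , refl
  ...   | true  | true  with () ← Zi
  ...   | false | _     with () ← Zi

  inZ∪Z'-x' : (i : Fin n) .(p : γ ≤ toℕ i) → inZ∪Z' S (x' i p) ≡ true → S (x i) ≡ false
  inZ∪Z'-x' i p Z'i = not≡true⇒≡false (∧-conicalʳ _ _ Z'i)

  inZ∪Z'⊆S : (v : Node n γ) → inZ∪Z' S v ≡ true → S v ≡ true
  inZ∪Z'⊆S (x i)    Zi  = proj₁ (proj₂ (inZ∪Z'-x i Zi))
  inZ∪Z'⊆S (x' i p) Z'i = ∧-conicalˡ _ _ Z'i

module _ {n γ : ℕ} (d : Fin n → ℕ) (S : Node n γ → Bool) where

  open Flow (allNodes n γ) (cap d)

  no-edge-into-Z∪Z' : (u v : Node n γ) → u ≢ s → (S ∖ inZ∪Z' S) u ≡ true → inZ∪Z' S v ≡ true →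
                      cap d u v ≡ 0
  no-edge-into-Z∪Z' u        (x j)    u≢s _  _   = cap-into-x d u j u≢s
  no-edge-into-Z∪Z' (x i)    (x' j p) _   Su Z'j with i ≟ᶠ j
  ... | no _     = refl
  ... | yes refl with () ← trans (sym (∧-conicalˡ _ _ Su)) (inZ∪Z'-x' S i p Z'j)
  no-edge-into-Z∪Z' s        (x' _ _) s≢s _  _   = ⊥-elim (s≢s refl)
  no-edge-into-Z∪Z' t        (x' _ _) _   _  _   = refl
  no-edge-into-Z∪Z' (y _)    (x' _ _) _   _  _   = refl
  no-edge-into-Z∪Z' (x' _ _) (x' _ _) _   _  _   = refl
  no-edge-into-Z∪Z' (y' _ _) (x' _ _) _   _  _   = refl

  flowFrom-into-Z∪Z'-≡0 : (u : Node n γ) → u ≢ s → flowFrom (S ∖ inZ∪Z' S) (inZ∪Z' S) u ≡ 0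
  flowFrom-into-Z∪Z'-≡0 u u≢s = sum-map-zero (All.universal (λ v →
    edgeCap-≡0 (S ∖ inZ∪Z' S) (inZ∪Z' S) u v (no-edge-into-Z∪Z' u v u≢s)) (allNodes n γ))

  module _ (j : Fin n) (j<γ : toℕ j < γ) (yj∉S : S (y j) ≡ false) where

    flowFrom-Z-≥ : (i : Fin n) → inZ∪Z' S (x i) ≡ true → d i ≤ flowFrom (inZ∪Z' S) (∁ S) (x i)
    flowFrom-Z-≥ i Zi with inZ∪Z'-x S i Zi
    ... | p , _ , x'i∉S = begin
      d i                                            ≤⟨ m≤n+m∸n (d i) 1 ⟩
      1 + (d i ∸ 1)                                  ≡⟨ cong₂ _+_ to-yj to-x'i ⟨
      F (y j) + F (x' i p)                           ≤⟨ +-mono-≤ (∈⇒≤-sum-map F yj∈Ys)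
                                                                  (∈⇒≤-sum-map F (∈-++⁺ˡ (∈-primedNodes x' i p))) ⟩
      sum (map F Ys) + sum (map F Primed)            ≡⟨ sum-map-++ F Ys Primed ⟨
      sum (map F (Ys ++ Primed))                     ≤⟨ m≤n+m _ _ ⟩
      sum (map F (s ∷ t ∷ Xs)) + sum (map F (Ys ++ Primed))
                                                     ≡⟨ sum-map-++ F (s ∷ t ∷ Xs) (Ys ++ Primed) ⟨
      flowFrom (inZ∪Z' S) (∁ S) (x i)                ∎
      where
      open ≤-Reasoning
      F : Node n γ → ℕ
      F = edgeCap (inZ∪Z' S) (∁ S) (x i)
      Xs Ys Primed : List (Node n γ)
      Xs = map x (allFin n)
      Ys = map y (allFin n)
      Primed = primedNodes x' ++ primedNodes y'
      yj∈Ys : y j ∈ Ys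
      yj∈Ys = ∈-map⁺ y (∈-allFin j)
      to-yj : F (y j) ≡ 1
      to-yj = trans (edgeCap-≡ (inZ∪Z' S) (∁ S) (x i) (y j) Zi (cong not yj∉S)) (cap-x-y d p j<γ)
      to-x'i : F (x' i p) ≡ d i ∸ 1
      to-x'i = trans (edgeCap-≡ (inZ∪Z' S) (∁ S) (x i) (x' i p) Zi (cong not x'i∉S)) (cap-x-x' d i p)

    cap-from-s-≤ : (v : Node n γ) → inZ∪Z' S v ≡ true → cap d s v ≤ flowFrom (inZ∪Z' S) (∁ S) v
    cap-from-s-≤ (x i)    Zi = flowFrom-Z-≥ i Zi
    cap-from-s-≤ (x' _ _) _  = z≤n

    flow-into-Z∪Z'-≤ : flow (S ∖ inZ∪Z' S) (inZ∪Z' S) ≤ flow (inZ∪Z' S) (∁ S)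
    flow-into-Z∪Z'-≤ = begin
      flow (S ∖ inZ∪Z' S) (inZ∪Z' S)      ≡⟨ sum-allNodes-source _ flowFrom-into-Z∪Z'-≡0 ⟩
      flowFrom (S ∖ inZ∪Z' S) (inZ∪Z' S) s
        ≤⟨ sum-map-mono (λ v → edgeCap-≤ (S ∖ inZ∪Z' S) (inZ∪Z' S) s v (λ _ → cap-from-s-≤ v))
                       (allNodes n γ) ⟩
      flow (inZ∪Z' S) (∁ S)                ∎
      where open ≤-Reasoning

lemma8 : (n γ : ℕ) (d : Fin n → ℕ) → (∀ i → 1 ≤ d i) → 1 ≤ γ → γ ≤ n →
    (S : Node n γ → Bool) → IsCut S →
    Σ (Fin n) (λ j → (toℕ j < γ) × (S (y j) ≡ false)) →
    cutCap d (S'of S) ≤ cutCap d S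
lemma8 n γ d _ _ _ S _ (j , j<γ , yj∉S) =
  Flow.cut-∖-≤ (allNodes n γ) (cap d) S (inZ∪Z' S) (inZ∪Z'⊆S S) (flow-into-Z∪Z'-≤ d S j j<γ yj∉S)
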